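{- Let $H=(V,E)$ be an unweighted hypergraph, let $C\subseteq V$, and let $T\subseteq E$ be a set of at most $k$ hyperedges. Then $\lambda_{H-T}(C) \ge \lambda_H(C) - k$, where $H-T=(V,E\setminus T)$.
   Context: For an unweighted hypergraph $G=(U,F)$ and a partition $U_1,\dots,U_j$ of $U$ ($j\ge 2$), let $F[U_1,\dots,U_j]$ be the set of hyperedges not contained in any single $U_i$. The minimum normalized $k$-cut is $\Phi(G)=\min_{j\in[2..|U|]}\min_{U_1\cup\dots\cup U_j=U}\frac{|F[U_1,\dots,U_j]|}{j-1}$. Strengths of hyperedges are defined recursively: take a partition $U_1,\dots,U_j$ achieving $\Phi(G)$; every hyperedge in $F[U_1,\dots,U_j]$ gets strength $\lambda_e=\Phi(G)$; every other hyperedge lies inside some $U_i$ and its strength is defined recursively as its strength in the induced sub-hypergraph $G[U_i]$ (hyperedges of $G$ contained in $U_i$). For $S\subseteq U$, the strength of $S$ in $G$ is $\lambda_G(S)=\min_{e\in G[S]}\lambda_e$, the minimum strength (in $G$) of a hyperedge of the induced sub-hypergraph $G[S]$; equivalently as used in the paper, $\lambda_G(S)=\Phi(G[S])$. -}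

module Defs where

open import Data.Nat using (ℕ; zero; suc)
open import Data.Bool using (Bool; true; false)
import Data.Bool.Properties as BoolP
open import Data.Fin using (Fin)
open import Data.Fin.Subset using (Subset; _∈_; _⊆_)
open import Data.Fin.Subset.Properties using (_∈?_; _⊆?_)
open import Data.Fin.Properties using (any?; all?)
open import Data.List using (List; filter; length)
import Data.List.Membership.DecPropositional as DecMem
open import Data.Vec.Properties using (≡-dec)
open import Data.Product using (Σ; ∃; _×_; _,_)
open import Data.Integer using (+_)
open import Data.Rational using (ℚ; _/_; _≤_)
open import Relation.Nullary using (Dec; yes; no; ¬_; ¬?)
open import Relation.Binary.PropositionalEquality using (_≡_)

-- An (unweighted) hypergraph on the vertex universe Fin n is given by
-- its vertex set U ⊆ Fin n together with its list of hyperedges,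
-- each hyperedge being a subset of Fin n (assumed ⊆ U where relevant).
Edges : ℕ → Set
Edges n = List (Subset n)

_≟ₑ_ : ∀ {n} (e f : Subset n) → Dec (e ≡ f)
_≟ₑ_ = ≡-dec BoolP._≟_

_∖_ : ∀ {n} → Edges n → Edges n → Edges n
_∖_ {n} E T = filter (λ e → ¬? (e ∈E? T)) E
  where open DecMem (_≟ₑ_ {n}) renaming (_∈?_ to _∈E?_)

induced : ∀ {n} → Subset n → Edges n → Edges n
induced S E = filter (λ e → e ⊆? S) E

-- A partition of the vertex set U into j nonempty parts U_1,…,U_j,
-- given by the part-label of each vertex of U (labels outside U are
-- irrelevant); every part is nonempty.
record Partition {n : ℕ} (U : Subset n) (j : ℕ) : Set where
  field
    part : Fin n → Fin j
    onto : ∀ (p : Fin j) → ∃ λ v → v ∈ U × part v ≡ p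
open Partition public

InOnePart : ∀ {n j} {U : Subset n} → Partition U j → Subset n → Set
InOnePart P e = ∃ λ p → ∀ v → v ∈ e → part P v ≡ p

inOnePart? : ∀ {n j} {U : Subset n} (P : Partition U j) (e : Subset n) →
             Dec (InOnePart P e)
inOnePart? P e = any? (λ p → all? (λ v → implies? v p))
  where
  implies? : ∀ v p → Dec (v ∈ e → part P v ≡ p)
  implies? v p with v ∈? e | part P v Data.Fin.Properties.≟ p
  ... | _      | yes q = yes (λ _ → q)
  ... | no v∉e | no _  = yes (λ v∈e → Data.Empty.⊥-elim (v∉e v∈e))
    where import Data.Empty
  ... | yes v∈e | no q = no (λ h → q (h v∈e))

crossing : ∀ {n j} {U : Subset n} → Partition U j → Edges n → Edges n
crossing P F = filter (λ e → ¬? (inOnePart? P e)) F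

-- |F[U_1,…,U_j]| / (j - 1), for j = 2 + i
normCut : ∀ {n} {U : Subset n} (F : Edges n) (i : ℕ) →
          Partition U (suc (suc i)) → ℚ
normCut F i P = (+ length (crossing P F)) / suc i

IsMinNormCut : ∀ {n} (U : Subset n) (F : Edges n) → ℚ → Set
IsMinNormCut U F φ =
  (∃ λ i → Σ (Partition U (suc (suc i))) λ P → φ ≡ normCut F i P)
  × (∀ i (P : Partition U (suc (suc i))) → φ ≤ normCut F i P)

IsStrength : ∀ {n} (E : Edges n) (S : Subset n) → ℚ → Set
IsStrength E S φ = IsMinNormCut S (induced S E) φ

-- Fix a partition P of C attaining Φ((H−T)[C]). The hyperedges of H[C] crossing P are
-- those of (H−T)[C] crossing P together with at most |T| ≤ k hyperedges of T, so
-- λ_H(C) ≤ |H[C] crossing P|/(j−1) ≤ (|(H−T)[C] crossing P| + k)/(j−1) ≤ λ_{H−T}(C) + k.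

module Submission where

open import Defs
open import Data.Nat using (ℕ; _≤_)
open import Data.Fin.Subset using (Subset; _⊆_)
open import Data.List using (List; length)
open import Data.List.Relation.Unary.All using (All)
open import Data.List.Relation.Unary.Unique.Propositional using (Unique)
open import Data.List.Membership.Propositional using (_∈_)
open import Data.Integer using (+_)
open import Data.Rational using (ℚ; _-_; _/_)
import Data.Rational as ℚ
open import Level using (Level)
open import Data.Bool using (true; false)
open import Data.Nat using (suc; _+_; _*_; z≤n; s≤s)
import Data.Nat.Properties as ℕ
import Data.Integer as ℤ
import Data.Integer.Properties as ℤ
open import Data.Rational using (0ℚ)
import Data.Rational.Properties as ℚ
import Data.Rational.Unnormalised as ℚᵘ
import Data.Rational.Unnormalised.Properties as ℚᵘ
open import Data.List using ([]; _∷_; _++_; filter)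
open import Data.List.Properties using (length-++-sucʳ)
open import Data.List.Relation.Unary.Any using (here; there)
open import Data.List.Relation.Unary.AllPairs using (_∷_)
import Data.List.Relation.Unary.All as All
import Data.List.Relation.Unary.Unique.Propositional.Properties as Unique
open import Data.List.Membership.Propositional.Properties
  using (∈-∃++; ∈-++⁻; ∈-++⁺ˡ; ∈-++⁺ʳ; ∈-filter⁻)
import Data.List.Membership.DecPropositional as DecMembership
open import Data.Product using (_,_; proj₂)
open import Data.Sum using (inj₁; inj₂)
open import Data.Fin.Subset.Properties using (_⊆?_)
open import Relation.Nullary using (does; ¬_; ¬?; contradiction)
open import Relation.Nullary.Decidable using (decidable-stable)
open import Relation.Unary using (Pred; Decidable)
open import Relation.Unary.Properties using (∁?)
open import Relation.Binary.Definitions using (DecidableEquality)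
open import Relation.Binary.PropositionalEquality
  using (_≡_; _≢_; refl; sym; trans; cong; cong₂; module ≡-Reasoning)

module _ {A : Set} {ℓ : Level} {P : Pred A ℓ} (P? : Decidable P) where

  length-filter+length-filter-∁ : ∀ xs →
    length (filter P? xs) + length (filter (∁? P?) xs) ≡ length xs
  length-filter+length-filter-∁ []       = refl
  length-filter+length-filter-∁ (x ∷ xs) with does (P? x)
  ... | true  = cong suc (length-filter+length-filter-∁ xs)
  ... | false = trans (ℕ.+-suc _ _) (cong suc (length-filter+length-filter-∁ xs))

module _ {A : Set} {ℓ₁ ℓ₂ : Level} {P : Pred A ℓ₁} {Q : Pred A ℓ₂}
         (P? : Decidable P) (Q? : Decidable Q) where

  filter-comm : ∀ xs → filter P? (filter Q? xs) ≡ filter Q? (filter P? xs)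
  filter-comm []       = refl
  filter-comm (x ∷ xs) with does (P? x) in px | does (Q? x) in qx
  ... | true  | true  rewrite px | qx = cong (x ∷_) (filter-comm xs)
  ... | true  | false rewrite qx = filter-comm xs
  ... | false | true  rewrite px = filter-comm xs
  ... | false | false = filter-comm xs

module _ {A : Set} where

  ∈-++-∷⁻ : ∀ {x y : A} as bs → y ∈ as ++ x ∷ bs → y ≢ x → y ∈ as ++ bs
  ∈-++-∷⁻ as bs y∈ y≢x with ∈-++⁻ as y∈
  ... | inj₁ y∈as         = ∈-++⁺ˡ y∈as
  ... | inj₂ (here y≡x)   = contradiction y≡x y≢x
  ... | inj₂ (there y∈bs) = ∈-++⁺ʳ as y∈bs

  Unique-⊆⇒length≤ : ∀ {xs ys : List A} → Unique xs → (∀ {x} → x ∈ xs → x ∈ ys) →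
                     length xs ≤ length ys
  Unique-⊆⇒length≤ {[]}     _             _      = z≤n
  Unique-⊆⇒length≤ {x ∷ xs} (x∉xs ∷ !xs) xs⊆ys with ∈-∃++ (xs⊆ys (here refl))
  ... | as , bs , refl = ℕ.≤-trans (s≤s (Unique-⊆⇒length≤ !xs xs⊆as++bs))
                                   (ℕ.≤-reflexive (sym (length-++-sucʳ as x bs)))
    where
    xs⊆as++bs : ∀ {y} → y ∈ xs → y ∈ as ++ bs
    xs⊆as++bs y∈xs = ∈-++-∷⁻ as bs (xs⊆ys (there y∈xs)) (λ y≡x → All.lookup x∉xs y∈xs (sym y≡x))

module _ {A : Set} (_≟_ : DecidableEquality A) where

  open DecMembership _≟_ using (_∈?_)

  Unique⇒length≤length-filter∉+length : ∀ {xs} ys → Unique xs →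
    length xs ≤ length (filter (λ x → ¬? (x ∈? ys)) xs) + length ys
  Unique⇒length≤length-filter∉+length {xs} ys !xs = begin
    length xs                                ≡⟨ length-filter+length-filter-∁ ∉ys? xs ⟨
    length (filter ∉ys? xs) + length ∈ys     ≤⟨ ℕ.+-monoʳ-≤ _ (Unique-⊆⇒length≤ !∈ys ∈ys⊆ys) ⟩
    length (filter ∉ys? xs) + length ys      ∎
    where
    open ℕ.≤-Reasoning
    ∉ys? : Decidable (λ x → ¬ x ∈ ys)
    ∉ys? x = ¬? (x ∈? ys)
    ∈ys : List A
    ∈ys = filter (∁? ∉ys?) xs
    !∈ys : Unique ∈ys
    !∈ys = Unique.filter⁺ (∁? ∉ys?) {xs} !xs
    ∈ys⊆ys : ∀ {x} → x ∈ ∈ys → x ∈ ys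
    ∈ys⊆ys {x} x∈ = decidable-stable (x ∈? ys) (proj₂ (∈-filter⁻ (∁? ∉ys?) {xs = xs} x∈))

module _ {n : ℕ} where

  open DecMembership (_≟ₑ_ {n}) using (_∈?_)

  crossing-induced-∖ : ∀ {j} {U : Subset n} (P : Partition U j) (C : Subset n) (E T : Edges n) →
    crossing P (induced C (E ∖ T)) ≡ filter (λ e → ¬? (e ∈? T)) (crossing P (induced C E))
  crossing-induced-∖ P C E T = begin
    filter crosses? (filter (_⊆? C) (filter ∉T? E))  ≡⟨ cong (filter crosses?) (filter-comm (_⊆? C) ∉T? E) ⟩
    filter crosses? (filter ∉T? (filter (_⊆? C) E))  ≡⟨ filter-comm crosses? ∉T? (filter (_⊆? C) E) ⟩
    filter ∉T? (filter crosses? (filter (_⊆? C) E))  ∎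
    where
    open ≡-Reasoning
    ∉T? : Decidable (λ e → ¬ e ∈ T)
    ∉T? e = ¬? (e ∈? T)
    crosses? : Decidable (λ e → ¬ InOnePart P e)
    crosses? e = ¬? (inOnePart? P e)

  length-crossing-induced-∖ : ∀ {j} {U : Subset n} (P : Partition U j) (C : Subset n) {E : Edges n} →
    Unique E → ∀ T →
    length (crossing P (induced C E)) ≤ length (crossing P (induced C (E ∖ T))) + length T
  length-crossing-induced-∖ P C {E} !E T
    rewrite crossing-induced-∖ P C E T
    = Unique⇒length≤length-filter∉+length _≟ₑ_ T
        (Unique.filter⁺ _ (Unique.filter⁺ (_⊆? C) !E))

toℚᵘ-/ : ∀ m e → ℚ.toℚᵘ (+ m / suc e) ℚᵘ.≃ ℚᵘ.mkℚᵘ (+ m) e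
toℚᵘ-/ m e = ℚ.toℚᵘ-fromℚᵘ (ℚᵘ.mkℚᵘ (+ m) e)

/-monoˡ-≤ : ∀ {m n} e → m ≤ n → + m / suc e ℚ.≤ + n / suc e
/-monoˡ-≤ {m} {n} e m≤n = ℚ.toℚᵘ-cancel-≤ (begin
  ℚ.toℚᵘ (+ m / suc e)  ≃⟨ toℚᵘ-/ m e ⟩
  ℚᵘ.mkℚᵘ (+ m) e       ≤⟨ ℚᵘ.*≤* (ℤ.*-monoʳ-≤-nonNeg (+ suc e) (ℤ.+≤+ m≤n)) ⟩
  ℚᵘ.mkℚᵘ (+ n) e       ≃⟨ toℚᵘ-/ n e ⟨
  ℚ.toℚᵘ (+ n / suc e)  ∎)
  where open ℚᵘ.≤-Reasoning

/-+-≤ : ∀ m k e → + (m + k) / suc e ℚ.≤ + m / suc e ℚ.+ + k / 1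
/-+-≤ m k e = ℚ.toℚᵘ-cancel-≤ unnormalised
  where
  M K D : ℤ.ℤ
  M = + m
  K = + k
  D = + suc e

  K≤K*D : K ℤ.≤ K ℤ.* D
  K≤K*D = ℤ.≤-trans (ℤ.≤-reflexive (sym (ℤ.*-identityʳ K)))
                    (ℤ.*-monoˡ-≤-nonNeg K (ℤ.+≤+ (s≤s z≤n)))

  cross-multiplied : + (m + k) ℤ.* + suc (e * 1) ℤ.≤ (M ℤ.* + 1 ℤ.+ K ℤ.* D) ℤ.* D
  cross-multiplied = begin
    + (m + k) ℤ.* + suc (e * 1)   ≡⟨ cong₂ ℤ._*_ (ℤ.pos-+ m k) (cong (λ d → + suc d) (ℕ.*-identityʳ e)) ⟩
    (M ℤ.+ K) ℤ.* D               ≤⟨ ℤ.*-monoʳ-≤-nonNeg D (ℤ.+-monoʳ-≤ M K≤K*D) ⟩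
    (M ℤ.+ K ℤ.* D) ℤ.* D         ≡⟨ cong (λ i → (i ℤ.+ K ℤ.* D) ℤ.* D) (ℤ.*-identityʳ M) ⟨
    (M ℤ.* + 1 ℤ.+ K ℤ.* D) ℤ.* D ∎
    where open ℤ.≤-Reasoning

  unnormalised : ℚ.toℚᵘ (+ (m + k) / suc e) ℚᵘ.≤ ℚ.toℚᵘ (+ m / suc e ℚ.+ + k / 1)
  unnormalised = begin
    ℚ.toℚᵘ (+ (m + k) / suc e)                  ≃⟨ toℚᵘ-/ (m + k) e ⟩
    ℚᵘ.mkℚᵘ (+ (m + k)) e                       ≤⟨ ℚᵘ.*≤* cross-multiplied ⟩
    ℚᵘ.mkℚᵘ (+ m) e ℚᵘ.+ ℚᵘ.mkℚᵘ (+ k) 0         ≃⟨ ℚᵘ.+-cong (toℚᵘ-/ m e) (toℚᵘ-/ k 0) ⟨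
    ℚ.toℚᵘ (+ m / suc e) ℚᵘ.+ ℚ.toℚᵘ (+ k / 1)  ≃⟨ ℚ.toℚᵘ-homo-+ (+ m / suc e) (+ k / 1) ⟨
    ℚ.toℚᵘ (+ m / suc e ℚ.+ + k / 1)            ∎
    where open ℚᵘ.≤-Reasoning

p≤q+r⇒p-r≤q : ∀ {p q r : ℚ} → p ℚ.≤ q ℚ.+ r → p ℚ.- r ℚ.≤ q
p≤q+r⇒p-r≤q {p} {q} {r} p≤q+r = begin
  p ℚ.- r              ≤⟨ ℚ.+-monoˡ-≤ (ℚ.- r) p≤q+r ⟩
  q ℚ.+ r ℚ.- r        ≡⟨ ℚ.+-assoc q r (ℚ.- r) ⟩
  q ℚ.+ (r ℚ.- r)      ≡⟨ cong (q ℚ.+_) (ℚ.+-inverseʳ r) ⟩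
  q ℚ.+ 0ℚ             ≡⟨ ℚ.+-identityʳ q ⟩
  q                    ∎
  where open ℚ.≤-Reasoning

mainTheorem4 : ∀ (n : ℕ) (V : Subset n) (E : Edges n) → Unique E → All (_⊆ V) E →
               ∀ (C : Subset n) → C ⊆ V →
               ∀ (k : ℕ) (T : Edges n) → Unique T → All (_∈ E) T → length T ≤ k →
               ∀ (λH λHT : ℚ) → IsStrength E C λH → IsStrength (E ∖ T) C λHT →
               λH - (+ k) / 1 ℚ.≤ λHT
mainTheorem4 _ _ E !E _ C _ k T _ _ |T|≤k λH λHT (_ , λH≤cut) ((i , P , λHT≡cut) , _) =
  p≤q+r⇒p-r≤q (begin
    λH                                        ≤⟨ λH≤cut i P ⟩
    normCut (induced C E) i P                 ≤⟨ /-monoˡ-≤ i cut≤cut∖T+k ⟩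
    + (cut∖T + k) / suc i                     ≤⟨ /-+-≤ cut∖T k i ⟩
    normCut (induced C (E ∖ T)) i P ℚ.+ K     ≡⟨ cong (ℚ._+ K) λHT≡cut ⟨
    λHT ℚ.+ K                                 ∎)
  where
  open ℚ.≤-Reasoning
  K : ℚ
  K = + k / 1
  cut∖T : ℕ
  cut∖T = length (crossing P (induced C (E ∖ T)))
  cut≤cut∖T+k : length (crossing P (induced C E)) ≤ cut∖T + k
  cut≤cut∖T+k = ℕ.≤-trans (length-crossing-induced-∖ P C !E T) (ℕ.+-monoʳ-≤ cut∖T |T|≤k)
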